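{- Call a tuple $(G,H,F,C_0,R_0)$ a counterexample if $G\in\mathcal{A}$, $C_0$ is a $3$-cycle of $G$, $H$ is a cover of $G$ with colors $1,\dots,s$ for some $s\ge1$, $F=(f_1,\dots,f_s)$ with $f_i(v)\in\{0,1,2\}$ and $|f(v)|\ge4$ for all $v$ and $i$, $R_0$ is a DP-$F$-coloring of $C_0$, and there is no DP-$F$-coloring $R$ of $(G,H)$ with $R_0\subseteq R$. If $(G,H,F,C_0,R_0)$ is a counterexample with $|V(G)|$ minimum among all counterexamples, then $G$ has no separating $3$-cycles.
   Context: All graphs are finite, simple and undirected; $G$ is considered with a fixed plane embedding, and a separating $3$-cycle is a $3$-cycle with vertices of $G$ both strictly inside and strictly outside it. Two cycles are adjacent if they share at least one edge; $\mathcal{A}$ is the family of planar graphs that do not contain a $3$-cycle, a $4$-cycle and a $5$-cycle which are pairwise adjacent. A cover of $G$ with colors $1,\dots,s$ is a graph $H$ with vertex set $V(G)\times\{1,\dots,s\}$ such that: each $\{u\}\times\{1,\dots,s\}$ induces a complete graph; for each edge $uv\in E(G)$ the edges of $H$ between $\{u\}\times\{1,\dots,s\}$ and $\{v\}\times\{1,\dots,s\}$ form a (possibly empty) matching; if $uv\notin E(G)$ there are no such edges. $|f(v)|=f_1(v)+\cdots+f_s(v)$. For a subgraph $G'$, a representative set of $G'$ contains exactly one element of $\{v\}\times\{1,\dots,s\}$ for each $v\in V(G')$; a DP-$F$-coloring of $G'$ is a representative set $R$ of $G'$ that can be linearly ordered so that each $(v,i)\in R$ has fewer than $f_i(v)$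 neighbors in $H$ among the elements of $R$ preceding it. -}

module Defs where

open import Data.Nat as ℕ using (ℕ; zero; suc; _≤_)
open import Data.Nat.DivMod using (_mod_)
open import Data.Fin as Fin using (Fin; toℕ)
open import Data.Fin.Properties using () renaming (_≟_ to _≟ᶠ_; _<?_ to _<ᶠ?_)
open import Data.Bool using (Bool; true; false; T; _∧_; _∨_; not)
open import Data.Product using (Σ; ∃; _×_; _,_)
open import Data.Sum using (_⊎_)
open import Data.List using (List; length; filterᵇ; allFin; map)
open import Data.Nat.ListAction using (sum)
open import Data.Integer as ℤ using (ℤ; 0ℤ)
open import Relation.Nullary using (¬_)
open import Relation.Nullary.Decidable using (⌊_⌋)
open import Relation.Binary.PropositionalEquality using (_≡_; _≢_)
open import Function using (id)
open import Function.Definitions using (Injective)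

record Graph (n : ℕ) : Set where
  field
    adj    : Fin n → Fin n → Bool
    sym    : ∀ u v → adj u v ≡ adj v u
    irrefl : ∀ v → adj v v ≡ false

Adj : ∀ {n} → Graph n → Fin n → Fin n → Set
Adj G u v = T (Graph.adj G u v)

next : ∀ {k} → Fin k → Fin k
next {suc m} i = (suc (toℕ i)) mod (suc m)

record Cycle {n} (G : Graph n) (k : ℕ) : Set where
  field
    vtx   : Fin k → Fin n
    inj   : Injective _≡_ _≡_ vtx
    edges : ∀ i → Adj G (vtx i) (vtx (next i))

open Cycle public

CyclesAdjacent : ∀ {n} {G : Graph n} {k l} → Cycle G k → Cycle G l → Set
CyclesAdjacent C D =
  ∃ λ i → ∃ λ j →
    (vtx C i ≡ vtx D j × vtx C (next i) ≡ vtx D (next j))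
    ⊎ (vtx C i ≡ vtx D (next j) × vtx C (next i) ≡ vtx D j)

-- Plane embeddings, realised as straight-line drawings with integer
-- coordinates (every plane embedding is equivalent to such a drawing:
-- Fáry / Schnyder grid drawings).

Point : Set
Point = ℤ × ℤ

orient : Point → Point → Point → ℤ
orient (px , py) (qx , qy) (rx , ry) =
  ((qx ℤ.- px) ℤ.* (ry ℤ.- py)) ℤ.- ((qy ℤ.- py) ℤ.* (rx ℤ.- px))

OnSegment : Point → Point → Point → Set
OnSegment (px , py) (qx , qy) (rx , ry) =
  orient (px , py) (qx , qy) (rx , ry) ≡ 0ℤ
  × (((px ℤ.- rx) ℤ.* (qx ℤ.- rx)) ℤ.+ ((py ℤ.- ry) ℤ.* (qy ℤ.- ry))) ℤ.≤ 0ℤ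

ProperCross : Point → Point → Point → Point → Set
ProperCross p q r s =
  (orient p q r ℤ.* orient p q s) ℤ.< 0ℤ × (orient r s p ℤ.* orient r s q) ℤ.< 0ℤ

record PlaneEmbedding {n} (G : Graph n) : Set where
  field
    pos            : Fin n → Point
    pos-inj        : Injective _≡_ _≡_ pos
    noVertexOnEdge : ∀ u v w → Adj G u v → w ≢ u → w ≢ v →
                     ¬ OnSegment (pos u) (pos v) (pos w)
    noCrossing     : ∀ u v x y → Adj G u v → Adj G x y →
                     ¬ ProperCross (pos u) (pos v) (pos x) (pos y)

open PlaneEmbedding public

Planar : ∀ {n} → Graph n → Set
Planar G = PlaneEmbedding G

StrictlyInside : Point → Point → Point → Point → Set
StrictlyInside a b c w =
  (0ℤ ℤ.< orient a b w × 0ℤ ℤ.< orient b c w × 0ℤ ℤ.< orient c a w)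
  ⊎ (orient a b w ℤ.< 0ℤ × orient b c w ℤ.< 0ℤ × orient c a w ℤ.< 0ℤ)

InClosedTriangle : Point → Point → Point → Point → Set
InClosedTriangle a b c w =
  (0ℤ ℤ.≤ orient a b w × 0ℤ ℤ.≤ orient b c w × 0ℤ ℤ.≤ orient c a w)
  ⊎ (orient a b w ℤ.≤ 0ℤ × orient b c w ℤ.≤ 0ℤ × orient c a w ℤ.≤ 0ℤ)

SeparatingTriangle : ∀ {n} {G : Graph n} → PlaneEmbedding G → Cycle G 3 → Set
SeparatingTriangle E C =
  (∃ λ w → StrictlyInside (p Fin.zero) (p (Fin.suc Fin.zero)) (p (Fin.suc (Fin.suc Fin.zero))) (pos E w))
  × (∃ λ w → ¬ InClosedTriangle (p Fin.zero) (p (Fin.suc Fin.zero)) (p (Fin.suc (Fin.suc Fin.zero))) (pos E w))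
  where
    p : Fin 3 → Point
    p i = pos E (vtx C i)

InA : ∀ {n} → Graph n → Set
InA G =
  Planar G ×
  ¬ (Σ (Cycle G 3) λ C₃ → Σ (Cycle G 4) λ C₄ → Σ (Cycle G 5) λ C₅ →
       CyclesAdjacent C₃ C₄ × CyclesAdjacent C₃ C₅ × CyclesAdjacent C₄ C₅)

-- Covers with colours Fin s  (colour i ∈ Fin s stands for i+1)

record Cover {n} (G : Graph n) (s : ℕ) : Set where
  field
    -- cross edges of H between fibres of different vertices
    M       : Fin n → Fin s → Fin n → Fin s → Bool
    M-sym   : ∀ u i v j → M u i v j ≡ M v j u i
    M-edge  : ∀ u i v j → T (M u i v j) → Adj G u v
    M-match : ∀ u i v j j′ → T (M u i v j) → T (M u i v j′) → j ≡ j′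

HAdjᵇ : ∀ {n} {G : Graph n} {s} → Cover G s →
        Fin n → Fin s → Fin n → Fin s → Bool
HAdjᵇ H u i v j = (⌊ u ≟ᶠ v ⌋ ∧ not ⌊ i ≟ᶠ j ⌋) ∨ Cover.M H u i v j

∣f∣ : ∀ {n s} → (Fin s → Fin n → ℕ) → Fin n → ℕ
∣f∣ {s = s} f v = sum (map (λ i → f i v) (allFin s))

-- DP-F-colouring of a subgraph G' with vertex set {t k | k : Fin m}
-- (t injective): the representative set R = {(t k, col k)} admits a
-- linear order (given by the injective position map ord) such that each
-- (t k, col k) has fewer than f_{col k}(t k) H-neighbours in R before it.
IsDPColoring : ∀ {n} {G : Graph n} {s} → Cover G s → (Fin s → Fin n → ℕ) →
               ∀ {m} → (Fin m → Fin n) → (Fin m → Fin s) → Set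
IsDPColoring H f {m} t col =
  Σ (Fin m → Fin m) λ ord → Injective _≡_ _≡_ ord ×
    (∀ k → length (filterᵇ (λ j → ⌊ ord j <ᶠ? ord k ⌋ ∧ HAdjᵇ H (t j) (col j) (t k) (col k))
                           (allFin m))
           ℕ.< f (col k) (t k))

record Counterexample (n : ℕ) : Set where
  field
    G      : Graph n
    G∈𝒜    : InA G
    C₀     : Cycle G 3
    s      : ℕ
    s≥1    : 1 ≤ s
    H      : Cover G s
    f      : Fin s → Fin n → ℕ
    f≤2    : ∀ i v → f i v ≤ 2
    ∣f∣≥4  : ∀ v → 4 ≤ ∣f∣ f v
    -- R₀ = {(vtx C₀ k, c₀ k) | k}, a representative set of C₀
    c₀     : Fin 3 → Fin s
    R₀-DP  : IsDPColoring H f (vtx C₀) c₀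
    noExt  : ¬ (Σ (Fin n → Fin s) λ c →
                  IsDPColoring H f id c × (∀ k → c (vtx C₀ k) ≡ c₀ k))

{-# OPTIONS --safe #-}
module Submission where

-- Let C be a separating triangle. One side of C contains no vertex of the precoloured
-- triangle C₀, because no edge joins a vertex strictly inside C to one strictly outside;
-- call it the interior. Every edge leaving the interior ends on C. Deleting the
-- interior leaves a smaller instance, so by minimality R₀ extends to it. The interior
-- together with C is a second smaller instance once the corners of C are precoloured
-- with the colours just found: the cover edges between corners are dropped, the corner
-- colours get weight 1, and two fresh colours of weight 2 keep |f| ≥ 4. Minimality
-- colours it too, and the two colourings glue if the outer vertices are listed first
-- and the interior follows in its own order. An interior vertex only sees interior
-- vertices and corners, and a corner of weight 1 has no earlier neighbour in the inner
-- order, so every vertex keeps its bound. This extends R₀ to all of G, a contradiction.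
-- The geometric input: in a straight-line plane drawing, no edge joins a vertex strictly
-- inside a triangle of the graph to a vertex that is neither inside it nor a corner.

open import Defs
open import Data.Bool using (Bool; true; false; T; not; _∧_; _∨_; if_then_else_)
open import Data.Empty using (⊥; ⊥-elim)
import Data.Fin as Fin
open Fin using (Fin; zero; suc; toℕ; fromℕ<; punchOut)
open import Data.Fin.Patterns using (0F; 1F; 2F)
open import Data.Product using (Σ; ∃; _×_; _,_; proj₁; proj₂)
open import Data.Sum using (_⊎_; inj₁; inj₂; [_,_]′)
open import Function using (_∘_; id)
open import Function.Definitions using (Injective)
open import Relation.Nullary using (¬_; Dec; yes; no)
open import Relation.Nullary.Decidable
  using (⌊_⌋; isYes≗does; does-⇔; T?; ¬?; _×-dec_; _⊎-dec_; toWitness; fromWitness; decidable-stable)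
open import Relation.Unary using (Decidable)
open import Relation.Binary.Definitions using (tri<; tri≈; tri>)
open import Relation.Binary.PropositionalEquality using (_≡_; _≢_; refl; sym; trans; cong; cong₂; subst; subst₂)

Adj-sym : ∀ {n} (G : Graph n) {u v} → Adj G u v → Adj G v u
Adj-sym G {u} {v} = subst T (Graph.sym G u v)

triangle-adjacent : ∀ {n} {G : Graph n} (D : Cycle G 3) {i j} → i ≢ j → Adj G (vtx D i) (vtx D j)
triangle-adjacent D {0F} {1F} _ = edges D 0F
triangle-adjacent D {1F} {2F} _ = edges D 1F
triangle-adjacent D {2F} {0F} _ = edges D 2F
triangle-adjacent {G = G} D {1F} {0F} _ = Adj-sym G (edges D 0F)
triangle-adjacent {G = G} D {2F} {1F} _ = Adj-sym G (edges D 1F)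
triangle-adjacent {G = G} D {0F} {2F} _ = Adj-sym G (edges D 2F)
triangle-adjacent D {0F} {0F} i≢i = ⊥-elim (i≢i refl)
triangle-adjacent D {1F} {1F} i≢i = ⊥-elim (i≢i refl)
triangle-adjacent D {2F} {2F} i≢i = ⊥-elim (i≢i refl)

if-yes : ∀ {p a} {P : Set p} {A : Set a} (d : Dec P) {x y : A} → P → (if ⌊ d ⌋ then x else y) ≡ x
if-yes (yes _) _ = refl
if-yes (no ¬p) p = ⊥-elim (¬p p)

if-no : ∀ {p a} {P : Set p} {A : Set a} (d : Dec P) {x y : A} → ¬ P → (if ⌊ d ⌋ then x else y) ≡ y
if-no (yes p) ¬p = ⊥-elim (¬p p)
if-no (no _) _ = refl

T-⌊⌋∧ : ∀ {p} {P : Set p} (d : Dec P) {b} → T (⌊ d ⌋ ∧ b) → P × T b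
T-⌊⌋∧ (yes p) h = p , h

module Geometry where
  open import Data.Nat using (z≤n; s≤s)
  open import Data.Integer using (ℤ; +_; -[1+_]; 0ℤ; _+_; _-_; _*_; -_; _<_; _≤_; +<+; -<+; +≤+)
  open import Data.Integer.Properties
    using ( *-zeroˡ; ≤-total; <-irrefl; <-asym; <⇒≤; <⇒≱; ≮⇒≥; ≰⇒>; ≤-antisym; ≤-reflexive; ≤-trans; ≤-<-trans
          ; <-cmp; _<?_; _≤?_; +-mono-<; +-mono-≤; +-mono-<-≤; +-monoʳ-<; +-identityʳ
          ; neg-mono-<; neg-mono-≤; neg-cancel-<; pos-*; *-zeroʳ)
  open import Data.Integer.Tactic.RingSolver using (solve-∀)

  pos*pos>0 : ∀ {x y} → 0ℤ < x → 0ℤ < y → 0ℤ < x * y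
  pos*pos>0 (+<+ (s≤s z≤n)) (+<+ (s≤s z≤n)) = +<+ (s≤s z≤n)

  pos*neg<0 : ∀ {x y} → 0ℤ < x → y < 0ℤ → x * y < 0ℤ
  pos*neg<0 (+<+ (s≤s z≤n)) -<+ = -<+

  neg*pos<0 : ∀ {x y} → x < 0ℤ → 0ℤ < y → x * y < 0ℤ
  neg*pos<0 -<+ (+<+ (s≤s z≤n)) = -<+

  nonNeg*nonNeg≥0 : ∀ {x y} → 0ℤ ≤ x → 0ℤ ≤ y → 0ℤ ≤ x * y
  nonNeg*nonNeg≥0 (+≤+ {n = m} z≤n) (+≤+ {n = n} z≤n) = ≤-trans (+≤+ z≤n) (≤-reflexive (pos-* m n))

  x*x≥0 : ∀ x → 0ℤ ≤ x * x
  x*x≥0 (+ n) = ≤-trans (+≤+ z≤n) (≤-reflexive (pos-* n n))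
  x*x≥0 -[1+ n ] = +≤+ z≤n

  neg⊎nonNeg : ∀ x → x < 0ℤ ⊎ 0ℤ ≤ x
  neg⊎nonNeg (+ n) = inj₂ (+≤+ z≤n)
  neg⊎nonNeg -[1+ n ] = inj₁ -<+

  pos*x<0⇒x<0 : ∀ {d x} → 0ℤ < d → d * x < 0ℤ → x < 0ℤ
  pos*x<0⇒x<0 {x = x} 0<d dx<0 with neg⊎nonNeg x
  ... | inj₁ x<0 = x<0
  ... | inj₂ 0≤x = ⊥-elim (<⇒≱ dx<0 (nonNeg*nonNeg≥0 (<⇒≤ 0<d) 0≤x))

  pos*x>0⇒x>0 : ∀ {d x} → 0ℤ < d → 0ℤ < d * x → 0ℤ < x
  pos*x>0⇒x>0 {d} {x} 0<d 0<dx with <-cmp 0ℤ x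
  ... | tri< 0<x _ _ = 0<x
  ... | tri≈ _ refl _ = ⊥-elim (<-irrefl (sym (*-zeroʳ d)) 0<dx)
  ... | tri> _ _ x<0 = ⊥-elim (<-asym 0<dx (pos*neg<0 0<d x<0))

  neg-nonNeg<0 : ∀ {x y} → x < 0ℤ → 0ℤ ≤ y → x - y < 0ℤ
  neg-nonNeg<0 x<0 0≤y = +-mono-<-≤ x<0 (neg-mono-≤ 0≤y)

  nonNeg-neg>0 : ∀ {x y} → 0ℤ ≤ x → y < 0ℤ → 0ℤ < x - y
  nonNeg-neg>0 {x} 0≤x y<0 = ≤-<-trans 0≤x (subst (_< x - _) (+-identityʳ x) (+-monoʳ-< x (neg-mono-< y<0)))

  pos*z+nonNeg≡0⇒z≤0 : ∀ {p q s z} → 0ℤ < p → 0ℤ ≤ q → 0ℤ ≤ s → p * z + q * s ≡ 0ℤ → z ≤ 0ℤ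
  pos*z+nonNeg≡0⇒z≤0 {z = z} 0<p 0≤q 0≤s e with z ≤? 0ℤ
  ... | yes z≤0 = z≤0
  ... | no z≰0 = ⊥-elim (<-irrefl (sym e) (+-mono-<-≤ (pos*pos>0 0<p (≰⇒> z≰0)) (nonNeg*nonNeg≥0 0≤q 0≤s)))

  -- OnSegment p q r is orient p q r ≡ 0ℤ together with inner p q r ≤ 0ℤ.
  inner : Point → Point → Point → ℤ
  inner (px , py) (qx , qy) (rx , ry) = (px - rx) * (qx - rx) + (py - ry) * (qy - ry)

  -- The ring solver needs explicit coordinates, so each identity is stated with orient unfolded.
  orient-repeat₁ : ∀ p q → orient p q p ≡ 0ℤ
  orient-repeat₁ (px , py) (qx , qy) = identity px py qx qy
    where
    identity : ∀ px py qx qy → (qx - px) * (py - py) - (qy - py) * (px - px) ≡ 0ℤ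
    identity = solve-∀

  orient-repeat₂ : ∀ p q → orient p q q ≡ 0ℤ
  orient-repeat₂ (px , py) (qx , qy) = identity px py qx qy
    where
    identity : ∀ px py qx qy → (qx - px) * (qy - py) - (qy - py) * (qx - px) ≡ 0ℤ
    identity = solve-∀

  orient-swap : ∀ p q r → orient q p r ≡ - orient p q r
  orient-swap (px , py) (qx , qy) (rx , ry) = identity px py qx qy rx ry
    where
    identity : ∀ px py qx qy rx ry →
      (px - qx) * (ry - qy) - (py - qy) * (rx - qx) ≡ - ((qx - px) * (ry - py) - (qy - py) * (rx - px))
    identity = solve-∀

  orient-split : ∀ a b c u → orient a b c ≡ orient a b u + orient b c u + orient c a u
  orient-split (ax , ay) (bx , by) (cx , cy) (ux , uy) = identity ax ay bx by cx cy ux uy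
    where
    identity : ∀ ax ay bx by cx cy ux uy →
      (bx - ax) * (cy - ay) - (by - ay) * (cx - ax)
      ≡ ((bx - ax) * (uy - ay) - (by - ay) * (ux - ax)) + ((cx - bx) * (uy - by) - (cy - by) * (ux - bx))
        + ((ax - cx) * (uy - cy) - (ay - cy) * (ux - cx))
    identity = solve-∀

  -- Locates the corner a relative to the line uw from the positions of u and w
  -- relative to the two sides through a.
  orient-cross : ∀ a b c u w →
    orient a b c * orient u w a ≡ orient c a u * orient a b w - orient a b u * orient c a w
  orient-cross (ax , ay) (bx , by) (cx , cy) (ux , uy) (wx , wy) = identity ax ay bx by cx cy ux uy wx wy
    where
    identity : ∀ ax ay bx by cx cy ux uy wx wy →
      ((bx - ax) * (cy - ay) - (by - ay) * (cx - ax)) * ((wx - ux) * (ay - uy) - (wy - uy) * (ax - ux))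
      ≡ ((ax - cx) * (uy - cy) - (ay - cy) * (ux - cx)) * ((bx - ax) * (wy - ay) - (by - ay) * (wx - ax))
        - ((bx - ax) * (uy - ay) - (by - ay) * (ux - ax)) * ((ax - cx) * (wy - cy) - (ay - cy) * (wx - cx))
    identity = solve-∀

  *-vanishˡ : ∀ {x} k → x ≡ 0ℤ → x * k ≡ 0ℤ
  *-vanishˡ k x≡0 = trans (cong (_* k) x≡0) (*-zeroˡ k)

  inner-self≥0 : ∀ p r → 0ℤ ≤ inner p p r
  inner-self≥0 (px , py) (rx , ry) = +-mono-≤ (x*x≥0 (px - rx)) (x*x≥0 (py - ry))

  -- γ, α, β denote the orientations of a point with respect to the sides ab, bc, ca.
  -- Once w lies on the line ab (resp. a on the line uw), these identities and the signs
  -- of the other orientations put it on the segment.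
  inner-on-line₁ : ∀ a b c w → orient a b w ≡ 0ℤ →
    orient c a w * inner a b w + orient b c w * inner a a w ≡ 0ℤ
  inner-on-line₁ (ax , ay) (bx , by) (cx , cy) (wx , wy) γ≡0 =
    trans (identity ax ay bx by cx cy wx wy) (*-vanishˡ _ γ≡0)
    where
    identity : ∀ ax ay bx by cx cy wx wy →
      ((ax - cx) * (wy - cy) - (ay - cy) * (wx - cx)) * ((ax - wx) * (bx - wx) + (ay - wy) * (by - wy))
      + ((cx - bx) * (wy - by) - (cy - by) * (wx - bx)) * ((ax - wx) * (ax - wx) + (ay - wy) * (ay - wy))
      ≡ ((bx - ax) * (wy - ay) - (by - ay) * (wx - ax))
        * (((bx - cx) * (ax - wx) + (by - cy) * (ay - wy)) - ((ax - wx) * (bx - wx) + (ay - wy) * (by - wy)))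
    identity = solve-∀

  inner-on-line₂ : ∀ a b c w → orient a b w ≡ 0ℤ →
    orient b c w * inner a b w + orient c a w * inner b b w ≡ 0ℤ
  inner-on-line₂ (ax , ay) (bx , by) (cx , cy) (wx , wy) γ≡0 =
    trans (identity ax ay bx by cx cy wx wy) (*-vanishˡ _ γ≡0)
    where
    identity : ∀ ax ay bx by cx cy wx wy →
      ((cx - bx) * (wy - by) - (cy - by) * (wx - bx)) * ((ax - wx) * (bx - wx) + (ay - wy) * (by - wy))
      + ((ax - cx) * (wy - cy) - (ay - cy) * (wx - cx)) * ((bx - wx) * (bx - wx) + (by - wy) * (by - wy))
      ≡ ((bx - ax) * (wy - ay) - (by - ay) * (wx - ax))
        * (((ax - cx) * (bx - wx) + (ay - cy) * (by - wy)) - ((ax - wx) * (bx - wx) + (ay - wy) * (by - wy)))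
    identity = solve-∀

  inner-through-corner : ∀ a c u w → orient u w a ≡ 0ℤ →
    orient c a u * inner u w a + (- orient c a w) * inner u u a ≡ 0ℤ
  inner-through-corner (ax , ay) (cx , cy) (ux , uy) (wx , wy) σ≡0 =
    trans (identity ax ay cx cy ux uy wx wy) (*-vanishˡ _ σ≡0)
    where
    identity : ∀ ax ay cx cy ux uy wx wy →
      ((ax - cx) * (uy - cy) - (ay - cy) * (ux - cx)) * ((ux - ax) * (wx - ax) + (uy - ay) * (wy - ay))
      + (- ((ax - cx) * (wy - cy) - (ay - cy) * (wx - cx))) * ((ux - ax) * (ux - ax) + (uy - ay) * (uy - ay))
      ≡ ((wx - ux) * (ay - uy) - (wy - uy) * (ax - ux)) * ((cx - ax) * (ux - ax) + (cy - ay) * (uy - ay))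
    identity = solve-∀

  pos-swap : ∀ p q r → orient p q r < 0ℤ → 0ℤ < orient q p r
  pos-swap p q r neg = subst (0ℤ <_) (sym (orient-swap p q r)) (neg-mono-< neg)

  neg-swap : ∀ p q r → 0ℤ < orient q p r → orient p q r < 0ℤ
  neg-swap p q r pos = neg-cancel-< (subst (0ℤ <_) (orient-swap p q r) pos)

  record Inside⁺ (a b c w : Point) : Set where
    constructor inside⁺
    field
      ab : 0ℤ < orient a b w
      bc : 0ℤ < orient b c w
      ca : 0ℤ < orient c a w

  Inside⁻ : Point → Point → Point → Point → Set
  Inside⁻ a b c w = orient a b w < 0ℤ × orient b c w < 0ℤ × orient c a w < 0ℤ

  inside⁺-rotate : ∀ {a b c w} → Inside⁺ a b c w → Inside⁺ b c a w
  inside⁺-rotate (inside⁺ γ α β) = inside⁺ α β γ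

  inside⁻⇒inside⁺-reversed : ∀ {a b c w} → Inside⁻ a b c w → Inside⁺ a c b w
  inside⁻⇒inside⁺-reversed {a} {b} {c} {w} (γ , α , β) = inside⁺ (pos-swap c a w β) (pos-swap b c w α) (pos-swap a b w γ)

  inside⁺-reversed⇒inside⁻ : ∀ {a b c w} → Inside⁺ a c b w → Inside⁻ a b c w
  inside⁺-reversed⇒inside⁻ {a} {b} {c} {w} (inside⁺ β α γ) = neg-swap a b w γ , neg-swap b c w α , neg-swap c a w β

  inside⁺⇒ccw : ∀ {a b c u} → Inside⁺ a b c u → 0ℤ < orient a b c
  inside⁺⇒ccw {a} {b} {c} {u} (inside⁺ γ α β) = subst (0ℤ <_) (sym (orient-split a b c u)) (+-mono-< (+-mono-< γ α) β)

  orient-corner<0 : ∀ {a b c u} w → Inside⁺ a b c u → orient a b w < 0ℤ → 0ℤ ≤ orient c a w → orient u w a < 0ℤ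
  orient-corner<0 {a} {b} {c} {u} w inside@(inside⁺ γu _ βu) γw βw =
    pos*x<0⇒x<0 (inside⁺⇒ccw inside)
      (subst (_< 0ℤ) (sym (orient-cross a b c u w)) (neg-nonNeg<0 (pos*neg<0 βu γw) (nonNeg*nonNeg≥0 (<⇒≤ γu) βw)))

  orient-corner>0 : ∀ {a b c u} w → Inside⁺ a b c u → 0ℤ ≤ orient a b w → orient c a w < 0ℤ → 0ℤ < orient u w a
  orient-corner>0 {a} {b} {c} {u} w inside@(inside⁺ γu _ βu) γw βw =
    pos*x>0⇒x>0 (inside⁺⇒ccw inside)
      (subst (0ℤ <_) (sym (orient-cross a b c u w)) (nonNeg-neg>0 (nonNeg*nonNeg≥0 (<⇒≤ βu) γw) (pos*neg<0 γu βw)))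

  data MeetsSide (u w p q : Point) : Set where
    crosses        : ProperCross u w p q → MeetsSide u w p q
    through-corner : OnSegment u w p → MeetsSide u w p q
    ends-on        : OnSegment p q w → MeetsSide u w p q

  exit-across-side : ∀ {a b c u} w → Inside⁺ a b c u →
    orient a b w < 0ℤ → 0ℤ ≤ orient b c w → 0ℤ ≤ orient c a w → ProperCross u w a b
  exit-across-side w inside@(inside⁺ γu _ _) γw αw βw =
    neg*pos<0 (orient-corner<0 w inside γw βw) (orient-corner>0 w (inside⁺-rotate inside) αw γw) , pos*neg<0 γu γw

  exit-near-corner : ∀ {a b c u} w → Inside⁺ a b c u →
    orient a b w < 0ℤ → 0ℤ ≤ orient b c w → orient c a w < 0ℤ → MeetsSide u w a b ⊎ MeetsSide u w c a
  exit-near-corner {a} {b} {c} {u} w inside@(inside⁺ γu _ βu) γw αw βw with <-cmp (orient u w a) 0ℤ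
  ... | tri< σ<0 _ _ =
    inj₁ (crosses (neg*pos<0 σ<0 (orient-corner>0 w (inside⁺-rotate inside) αw γw) , pos*neg<0 γu γw))
  ... | tri> _ _ σ>0 =
    inj₂ (crosses (neg*pos<0 (orient-corner<0 w (inside⁺-rotate (inside⁺-rotate inside)) βw αw) σ>0 , pos*neg<0 βu βw))
  ... | tri≈ _ σ≡0 _ =
    inj₁ (through-corner (σ≡0 , pos*z+nonNeg≡0⇒z≤0 βu (<⇒≤ (neg-mono-< βw)) (inner-self≥0 u a) (inner-through-corner a c u w σ≡0)))

  exit-onto-side : ∀ {a b c u} w → Inside⁺ a b c u →
    orient a b w ≡ 0ℤ → 0ℤ ≤ orient b c w → 0ℤ ≤ orient c a w → OnSegment a b w
  exit-onto-side {a} {b} {c} {u} w inside γ≡0 αw βw = γ≡0 , inner≤0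
    where
    inner≤0 : inner a b w ≤ 0ℤ
    inner≤0 with 0ℤ <? orient c a w | 0ℤ <? orient b c w
    ... | yes β>0 | _ = pos*z+nonNeg≡0⇒z≤0 β>0 αw (inner-self≥0 a w) (inner-on-line₁ a b c w γ≡0)
    ... | no _ | yes α>0 = pos*z+nonNeg≡0⇒z≤0 α>0 βw (inner-self≥0 b w) (inner-on-line₂ a b c w γ≡0)
    ... | no β≯0 | no α≯0 = ⊥-elim (<-irrefl (sym ccw≡0) (inside⁺⇒ccw inside))
      where
      ccw≡0 : orient a b c ≡ 0ℤ
      ccw≡0 = trans (orient-split a b c w)
        (cong₂ _+_ (cong₂ _+_ γ≡0 (≤-antisym (≮⇒≥ α≯0) αw)) (≤-antisym (≮⇒≥ β≯0) βw))

  -- One negative orientation of w: uw crosses that side. Two: it leaves near their common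
  -- corner. None: w lies on a side.
  leaves-triangle : ∀ {a b c u w} → Inside⁺ a b c u → ¬ Inside⁺ a b c w →
    MeetsSide u w a b ⊎ MeetsSide u w b c ⊎ MeetsSide u w c a
  leaves-triangle {a} {b} {c} {u} {w} inside outside
    with neg⊎nonNeg (orient a b w) | neg⊎nonNeg (orient b c w) | neg⊎nonNeg (orient c a w)
  ... | inj₁ γ | inj₂ α | inj₂ β = inj₁ (crosses (exit-across-side w inside γ α β))
  ... | inj₂ γ | inj₁ α | inj₂ β = inj₂ (inj₁ (crosses (exit-across-side w (inside⁺-rotate inside) α β γ)))
  ... | inj₂ γ | inj₂ α | inj₁ β = inj₂ (inj₂ (crosses (exit-across-side w (inside⁺-rotate (inside⁺-rotate inside)) β γ α)))
  ... | inj₁ γ | inj₂ α | inj₁ β = [ inj₁ , inj₂ ∘ inj₂ ]′ (exit-near-corner w inside γ α β)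
  ... | inj₁ γ | inj₁ α | inj₂ β = [ inj₂ ∘ inj₁ , inj₁ ]′ (exit-near-corner w (inside⁺-rotate inside) α β γ)
  ... | inj₂ γ | inj₁ α | inj₁ β =
    [ inj₂ ∘ inj₂ , inj₂ ∘ inj₁ ]′ (exit-near-corner w (inside⁺-rotate (inside⁺-rotate inside)) β γ α)
  ... | inj₁ γ | inj₁ α | inj₁ β =
    ⊥-elim (<-asym (inside⁺⇒ccw inside) (subst (_< 0ℤ) (sym (orient-split a b c w)) (+-mono-< (+-mono-< γ α) β)))
  ... | inj₂ γ | inj₂ α | inj₂ β with 0ℤ <? orient a b w | 0ℤ <? orient b c w | 0ℤ <? orient c a w
  ...   | yes γ>0 | yes α>0 | yes β>0 = ⊥-elim (outside (inside⁺ γ>0 α>0 β>0))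
  ...   | no γ≯0 | _ | _ =
    inj₁ (ends-on (exit-onto-side w inside (≤-antisym (≮⇒≥ γ≯0) γ) α β))
  ...   | yes _ | no α≯0 | _ =
    inj₂ (inj₁ (ends-on (exit-onto-side w (inside⁺-rotate inside) (≤-antisym (≮⇒≥ α≯0) α) β γ)))
  ...   | yes _ | yes _ | no β≯0 =
    inj₂ (inj₂ (ends-on (exit-onto-side w (inside⁺-rotate (inside⁺-rotate inside)) (≤-antisym (≮⇒≥ β≯0) β) γ α)))

  inside⁺⇒≢corner : ∀ {a b c u} → Inside⁺ a b c u → a ≢ u
  inside⁺⇒≢corner {a} {b} (inside⁺ γ _ _) refl = <-irrefl (sym (orient-repeat₁ a b)) γ

  on-a-side-line⇒¬strictlyInside : ∀ a b c w →
    orient a b w ≡ 0ℤ ⊎ orient b c w ≡ 0ℤ ⊎ orient c a w ≡ 0ℤ → ¬ StrictlyInside a b c w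
  on-a-side-line⇒¬strictlyInside _ _ _ _ (inj₁ γ≡0) (inj₁ (γ , _)) = <-irrefl (sym γ≡0) γ
  on-a-side-line⇒¬strictlyInside _ _ _ _ (inj₁ γ≡0) (inj₂ (γ , _)) = <-irrefl γ≡0 γ
  on-a-side-line⇒¬strictlyInside _ _ _ _ (inj₂ (inj₁ α≡0)) (inj₁ (_ , α , _)) = <-irrefl (sym α≡0) α
  on-a-side-line⇒¬strictlyInside _ _ _ _ (inj₂ (inj₁ α≡0)) (inj₂ (_ , α , _)) = <-irrefl α≡0 α
  on-a-side-line⇒¬strictlyInside _ _ _ _ (inj₂ (inj₂ β≡0)) (inj₁ (_ , _ , β)) = <-irrefl (sym β≡0) β
  on-a-side-line⇒¬strictlyInside _ _ _ _ (inj₂ (inj₂ β≡0)) (inj₂ (_ , _ , β)) = <-irrefl β≡0 β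

  vertex-closed : ∀ a b c w → orient a b w ≡ 0ℤ → orient c a w ≡ 0ℤ → InClosedTriangle a b c w
  vertex-closed a b c w γ≡0 β≡0 with ≤-total 0ℤ (orient b c w)
  ... | inj₁ α≥0 = inj₁ (≤-reflexive (sym γ≡0) , α≥0 , ≤-reflexive (sym β≡0))
  ... | inj₂ α≤0 = inj₂ (≤-reflexive γ≡0 , α≤0 , ≤-reflexive β≡0)

  closed-rotate : ∀ a b c w → InClosedTriangle b c a w → InClosedTriangle a b c w
  closed-rotate _ _ _ _ (inj₁ (α , β , γ)) = inj₁ (γ , α , β)
  closed-rotate _ _ _ _ (inj₂ (α , β , γ)) = inj₂ (γ , α , β)

  strictlyInside⇒closed : ∀ a b c w → StrictlyInside a b c w → InClosedTriangle a b c w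
  strictlyInside⇒closed _ _ _ _ (inj₁ (γ , α , β)) = inj₁ (<⇒≤ γ , <⇒≤ α , <⇒≤ β)
  strictlyInside⇒closed _ _ _ _ (inj₂ (γ , α , β)) = inj₂ (<⇒≤ γ , <⇒≤ α , <⇒≤ β)

  strictlyInside? : ∀ a b c w → Dec (StrictlyInside a b c w)
  strictlyInside? a b c w =
    (0ℤ <? orient a b w ×-dec 0ℤ <? orient b c w ×-dec 0ℤ <? orient c a w)
    ⊎-dec (orient a b w <? 0ℤ ×-dec orient b c w <? 0ℤ ×-dec orient c a w <? 0ℤ)

  module _ {n} {G : Graph n} (E : PlaneEmbedding G) where
    no-exit-through-side : ∀ {u w p q r} → Adj G u w → Adj G p q → Inside⁺ (pos E p) (pos E q) (pos E r) (pos E u) →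
      w ≢ p → w ≢ q → ¬ MeetsSide (pos E u) (pos E w) (pos E p) (pos E q)
    no-exit-through-side uw pq _ _ _ (crosses cross) = noCrossing E _ _ _ _ uw pq cross
    no-exit-through-side uw pq inside w≢p _ (through-corner p∈uw) =
      noVertexOnEdge E _ _ _ uw (inside⁺⇒≢corner inside ∘ cong (pos E)) (w≢p ∘ sym) p∈uw
    no-exit-through-side uw pq _ w≢p w≢q (ends-on w∈pq) = noVertexOnEdge E _ _ _ pq w≢p w≢q w∈pq

    triangle-separates : ∀ {a b c u w} → Adj G a b → Adj G b c → Adj G c a → w ≢ a → w ≢ b → w ≢ c →
      Inside⁺ (pos E a) (pos E b) (pos E c) (pos E u) → ¬ Inside⁺ (pos E a) (pos E b) (pos E c) (pos E w) →
      ¬ Adj G u w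
    triangle-separates ab bc ca w≢a w≢b w≢c inside outside uw with leaves-triangle inside outside
    ... | inj₁ meets = no-exit-through-side uw ab inside w≢a w≢b meets
    ... | inj₂ (inj₁ meets) = no-exit-through-side uw bc (inside⁺-rotate inside) w≢b w≢c meets
    ... | inj₂ (inj₂ meets) = no-exit-through-side uw ca (inside⁺-rotate (inside⁺-rotate inside)) w≢c w≢a meets

    module _ (C : Cycle G 3) where
      private
        p q r : Point
        p = pos E (vtx C 0F)
        q = pos E (vtx C 1F)
        r = pos E (vtx C 2F)

      Inside : Fin n → Set
      Inside v = StrictlyInside p q r (pos E v)

      InClosed : Fin n → Set
      InClosed v = InClosedTriangle p q r (pos E v)

      inside? : ∀ v → Dec (Inside v)
      inside? v = strictlyInside? p q r (pos E v)

      inside⇒closed : ∀ {v} → Inside v → InClosed v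
      inside⇒closed {v} = strictlyInside⇒closed p q r (pos E v)

      corner-not-inside : ∀ k → ¬ Inside (vtx C k)
      corner-not-inside 0F = on-a-side-line⇒¬strictlyInside p q r p (inj₁ (orient-repeat₁ p q))
      corner-not-inside 1F = on-a-side-line⇒¬strictlyInside p q r q (inj₁ (orient-repeat₂ p q))
      corner-not-inside 2F = on-a-side-line⇒¬strictlyInside p q r r (inj₂ (inj₁ (orient-repeat₂ q r)))

      corner-closed : ∀ k → InClosed (vtx C k)
      corner-closed 0F = vertex-closed p q r p (orient-repeat₁ p q) (orient-repeat₂ r p)
      corner-closed 1F = closed-rotate p q r q (vertex-closed q r p q (orient-repeat₁ q r) (orient-repeat₂ p q))
      corner-closed 2F =
        closed-rotate p q r r (closed-rotate q r p r (vertex-closed r p q r (orient-repeat₁ r p) (orient-repeat₂ q r)))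

      inside-nonadjacent : ∀ {u w} → Inside u → ¬ Inside w → (∀ k → w ≢ vtx C k) → ¬ Adj G u w
      inside-nonadjacent (inj₁ inside) outside w∉C =
        triangle-separates (edges C 0F) (edges C 1F) (edges C 2F) (w∉C 0F) (w∉C 1F) (w∉C 2F)
          (inside⁺ (proj₁ inside) (proj₁ (proj₂ inside)) (proj₂ (proj₂ inside)))
          (λ { (inside⁺ γ α β) → outside (inj₁ (γ , α , β)) })
      inside-nonadjacent (inj₂ inside) outside w∉C =
        triangle-separates (Adj-sym G (edges C 2F)) (Adj-sym G (edges C 1F)) (Adj-sym G (edges C 0F))
          (w∉C 0F) (w∉C 2F) (w∉C 1F)
          (inside⁻⇒inside⁺-reversed inside) (outside ∘ inj₂ ∘ inside⁺-reversed⇒inside⁻)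

open Geometry using (Inside; inside?; InClosed; inside⇒closed; corner-not-inside; corner-closed; inside-nonadjacent)

open import Data.Bool.Properties using (T-∧; T-∨; ∧-comm)
open import Data.Fin.Properties
  using (_≟_; _<?_; <⇒≢; any?; all?; suc-injective; toℕ<n; toℕ-injective; toℕ-fromℕ<; injective⇒≤; punchOut-injective)
open import Data.List using (length; filterᵇ; allFin; tabulate)
open import Data.List.Properties using (filter-≐; map-tabulate)
open import Data.Nat using (ℕ; zero; suc; _+_; _<_; _≤_; _<ᵇ_; z≤n; s≤s; s≤s⁻¹)
open import Data.Nat.ListAction using (sum)
open import Data.Nat.Properties
  using ( ≤-refl; ≤-reflexive; ≤-trans; <-trans; <-≤-trans; ≤-<-trans; <-irrefl; <-cmp; <⇒≤; <⇒≱; ≮⇒≥; ≤∧≢⇒<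
        ; <ᵇ⇒<; <⇒<ᵇ; m≤m+n; +-cancelˡ-<; +-cancelˡ-≡)
open import Data.Unit using (tt)
open import Function.Bundles using (mk⇔; module Equivalence)

-- Subsets of Fin n

count : ∀ {n} → (Fin n → Bool) → ℕ
count {zero} p = 0
count {suc n} p = if p zero then suc (count (p ∘ suc)) else count (p ∘ suc)

length-filterᵇ-tabulate : ∀ {a} {A : Set a} {n} (p : A → Bool) (g : Fin n → A) →
  length (filterᵇ p (tabulate g)) ≡ count (p ∘ g)
length-filterᵇ-tabulate {n = zero} p g = refl
length-filterᵇ-tabulate {n = suc n} p g with p (g zero)
... | true = cong suc (length-filterᵇ-tabulate p (g ∘ suc))
... | false = length-filterᵇ-tabulate p (g ∘ suc)

filterᵇ-cong : ∀ {a} {A : Set a} {p q : A → Bool} → (∀ x → p x ≡ q x) → ∀ xs → filterᵇ p xs ≡ filterᵇ q xs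
filterᵇ-cong p≡q = filter-≐ (T? ∘ _) (T? ∘ _) ((λ {x} → subst T (p≡q x)) , (λ {x} → subst T (sym (p≡q x))))

enum : ∀ {n} (p : Fin n → Bool) → Fin (count p) → Fin n
enum {suc n} p i with p zero
enum {suc n} p zero    | true = zero
enum {suc n} p (suc i) | true = suc (enum (p ∘ suc) i)
enum {suc n} p i       | false = suc (enum (p ∘ suc) i)

enum-satisfies : ∀ {n} (p : Fin n → Bool) i → T (p (enum p i))
enum-satisfies {suc n} p i with p zero in eq
enum-satisfies {suc n} p zero    | true = subst T (sym eq) tt
enum-satisfies {suc n} p (suc i) | true = enum-satisfies (p ∘ suc) i
enum-satisfies {suc n} p i       | false = enum-satisfies (p ∘ suc) i

enum-injective : ∀ {n} (p : Fin n → Bool) → Injective _≡_ _≡_ (enum p)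
enum-injective {suc n} p {i} {j} e with p zero
enum-injective {suc n} p {zero}  {zero}  e | true = refl
enum-injective {suc n} p {suc i} {suc j} e | true = cong suc (enum-injective (p ∘ suc) (suc-injective e))
enum-injective {suc n} p {i}     {j}     e | false = enum-injective (p ∘ suc) (suc-injective e)

index : ∀ {n} (p : Fin n → Bool) x → T (p x) → Fin (count p)
index {suc n} p zero px with p zero
... | true = zero
index {suc n} p (suc x) px with p zero
... | true = suc (index (p ∘ suc) x px)
... | false = index (p ∘ suc) x px

enum-index : ∀ {n} (p : Fin n → Bool) x (px : T (p x)) → enum p (index p x px) ≡ x
enum-index {suc n} p zero px with p zero
... | true = refl
enum-index {suc n} p (suc x) px with p zero
... | true = cong suc (enum-index (p ∘ suc) x px)
... | false = cong suc (enum-index (p ∘ suc) x px)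

private
  choose : ∀ {a} {A : Set a} (b : Bool) → (T b → A) → A → A
  choose true g _ = g tt
  choose false _ d = d

  choose-true : ∀ {a} {A : Set a} (b : Bool) (g : T b → A) d (h : T b) → choose b g d ≡ g h
  choose-true true g d h = refl

indexOr : ∀ {n} (p : Fin n → Bool) → Fin (count p) → Fin n → Fin (count p)
indexOr p d x = choose (p x) (index p x) d

enum-indexOr : ∀ {n} (p : Fin n → Bool) d x → T (p x) → enum p (indexOr p d x) ≡ x
enum-indexOr p d x px = trans (cong (enum p) (choose-true (p x) (index p x) d px)) (enum-index p x px)

indexOr-enum : ∀ {n} (p : Fin n → Bool) d i → indexOr p d (enum p i) ≡ i
indexOr-enum p d i = enum-injective p (enum-indexOr p d (enum p i) (enum-satisfies p i))

injective∧missing⇒< : ∀ {m n} (f : Fin m → Fin n) → Injective _≡_ _≡_ f → (y : Fin n) → (∀ i → f i ≢ y) → m < n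
injective∧missing⇒< {n = suc n} f f-inj y f≢y =
  s≤s (injective⇒≤ {f = λ i → punchOut (f≢y i ∘ sym)} λ {i} {j} → f-inj ∘ punchOut-injective (f≢y i ∘ sym) (f≢y j ∘ sym))

count<n : ∀ {n} (p : Fin n → Bool) x → ¬ T (p x) → count p < n
count<n p x ¬px = injective∧missing⇒< (enum p) (enum-injective p) x
  (λ i enum≡x → ¬px (subst (T ∘ p) enum≡x (enum-satisfies p i)))

count-pos : ∀ {n} (p : Fin n → Bool) x → T (p x) → 0 < count p
count-pos p x px = ≤-<-trans z≤n (toℕ<n (index p x px))

count-≤ : ∀ {m n} (p : Fin n → Bool) (q : Fin m → Bool) (h : Fin m → Fin n) →
  (∀ x → T (p x) → ∃ λ y → h y ≡ x × T (q y)) → count p ≤ count q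
count-≤ p q h cover = injective⇒≤ {f = F} F-injective
  where
  preimage : ∀ i → ∃ λ y → h y ≡ enum p i × T (q y)
  preimage i = cover (enum p i) (enum-satisfies p i)

  F : Fin (count p) → Fin (count q)
  F i = index q (proj₁ (preimage i)) (proj₂ (proj₂ (preimage i)))

  F-injective : Injective _≡_ _≡_ F
  F-injective {i} {j} e = enum-injective p (trans (sym (proj₁ (proj₂ (preimage i))))
    (trans (cong h same-preimage) (proj₁ (proj₂ (preimage j)))))
    where
    same-preimage : proj₁ (preimage i) ≡ proj₁ (preimage j)
    same-preimage = trans (sym (enum-index q _ _)) (trans (cong (enum q) e) (enum-index q _ _))

count-< : ∀ {n} (p q : Fin n → Bool) → (∀ x → T (p x) → T (q x)) → ∀ y → T (q y) → ¬ T (p y) → count p < count q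
count-< p q p⊆q y qy ¬py = injective∧missing⇒< F F-injective (index q y qy) F-misses
  where
  F : Fin (count p) → Fin (count q)
  F i = index q (enum p i) (p⊆q _ (enum-satisfies p i))

  F-injective : Injective _≡_ _≡_ F
  F-injective e = enum-injective p (trans (sym (enum-index q _ _)) (trans (cong (enum q) e) (enum-index q _ _)))

  F-misses : ∀ i → F i ≢ index q y qy
  F-misses i e = ¬py (subst (T ∘ p) (trans (sym (enum-index q _ _)) (trans (cong (enum q) e) (enum-index q y qy)))
                              (enum-satisfies p i))

count-none : ∀ {n} (p : Fin n → Bool) → (∀ x → ¬ T (p x)) → count p ≡ 0
count-none {zero} p none = refl
count-none {suc n} p none with p zero | none zero
... | true | ¬p0 = ⊥-elim (¬p0 tt)
... | false | _ = count-none (p ∘ suc) (none ∘ suc)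

module Rank {n} (key : Fin n → ℕ) (key-injective : Injective _≡_ _≡_ key) where
  below : Fin n → Fin n → Bool
  below v u = key u <ᵇ key v

  rank : Fin n → Fin n
  rank v = fromℕ< (count<n (below v) v (<-irrefl refl ∘ <ᵇ⇒< (key v) (key v)))

  toℕ-rank : ∀ v → toℕ (rank v) ≡ count (below v)
  toℕ-rank v = toℕ-fromℕ< _

  rank-mono : ∀ {j k} → key j ≤ key k → toℕ (rank j) ≤ toℕ (rank k)
  rank-mono {j} {k} kj≤kk = subst₂ _≤_ (sym (toℕ-rank j)) (sym (toℕ-rank k))
    (count-≤ (below j) (below k) id λ u u<j → u , refl , <⇒<ᵇ (<-≤-trans (<ᵇ⇒< _ _ u<j) kj≤kk))

  rank-strict : ∀ {j k} → key j < key k → toℕ (rank j) < toℕ (rank k)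
  rank-strict {j} {k} kj<kk = subst₂ _<_ (sym (toℕ-rank j)) (sym (toℕ-rank k))
    (count-< (below j) (below k) (λ u u<j → <⇒<ᵇ (<-trans (<ᵇ⇒< _ _ u<j) kj<kk)) j (<⇒<ᵇ kj<kk)
             (<-irrefl refl ∘ <ᵇ⇒< (key j) (key j)))

  rank<⇒key< : ∀ {j k} → rank j Fin.< rank k → key j < key k
  rank<⇒key< {j} {k} rj<rk with <-cmp (key j) (key k)
  ... | tri< kj<kk _ _ = kj<kk
  ... | tri≈ _ kj≡kk _ = ⊥-elim (<-irrefl (cong (toℕ ∘ rank) (key-injective kj≡kk)) rj<rk)
  ... | tri> _ _ kj>kk = ⊥-elim (<⇒≱ rj<rk (rank-mono (<⇒≤ kj>kk)))

  rank-injective : Injective _≡_ _≡_ rank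
  rank-injective {j} {k} rj≡rk with <-cmp (key j) (key k)
  ... | tri< kj<kk _ _ = ⊥-elim (<-irrefl (cong toℕ rj≡rk) (rank-strict kj<kk))
  ... | tri≈ _ kj≡kk _ = key-injective kj≡kk
  ... | tri> _ _ kj>kk = ⊥-elim (<-irrefl (cong toℕ (sym rj≡rk)) (rank-strict kj>kk))

-- DP-colourings of covers and their restrictions

HAdj-distinct : ∀ {n} {G : Graph n} {s} (H : Cover G s) {u v} i j → u ≢ v → HAdjᵇ H u i v j ≡ Cover.M H u i v j
HAdj-distinct H {u} {v} i j u≢v with u ≟ v
... | yes u≡v = ⊥-elim (u≢v u≡v)
... | no _ = refl

M⇒HAdj : ∀ {n} {G : Graph n} {s} (H : Cover G s) {u i v j} → T (Cover.M H u i v j) → T (HAdjᵇ H u i v j)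
M⇒HAdj H = Equivalence.from T-∨ ∘ inj₂

IsDPColoring-transport : ∀ {n n′} {G : Graph n} {G′ : Graph n′} {s} {H : Cover G s} {H′ : Cover G′ s}
  {f : Fin s → Fin n → ℕ} {f′ : Fin s → Fin n′ → ℕ} {m} {τ : Fin m → Fin n} {τ′ : Fin m → Fin n′} {col : Fin m → Fin s} →
  (∀ j k → HAdjᵇ H (τ j) (col j) (τ k) (col k) ≡ HAdjᵇ H′ (τ′ j) (col j) (τ′ k) (col k)) →
  (∀ k → f (col k) (τ k) ≡ f′ (col k) (τ′ k)) →
  IsDPColoring H f τ col → IsDPColoring H′ f′ τ′ col
IsDPColoring-transport adj≡ f≡ (ord , ord-injective , bound) =
  ord , ord-injective , λ k →
    subst₂ _<_ (cong length (filterᵇ-cong (λ j → cong (⌊ ord j <? ord k ⌋ ∧_) (adj≡ j k)) (allFin _))) (f≡ k) (bound k)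

module Pullback {m n} (G : Graph n) (t : Fin m → Fin n) (t-injective : Injective _≡_ _≡_ t) where
  graph : Graph m
  graph = record
    { adj = λ u v → Graph.adj G (t u) (t v)
    ; sym = λ u v → Graph.sym G (t u) (t v)
    ; irrefl = λ v → Graph.irrefl G (t v)
    }

  cycle↑ : ∀ {k} → Cycle graph k → Cycle G k
  cycle↑ D = record { vtx = t ∘ vtx D ; inj = inj D ∘ t-injective ; edges = edges D }

  cycle↓ : ∀ {k} (D : Cycle G k) (r : Fin n → Fin m) → (∀ i → t (r (vtx D i)) ≡ vtx D i) → Cycle graph k
  cycle↓ D r section = record
    { vtx = r ∘ vtx D
    ; inj = λ {i} {j} e → inj D (trans (sym (section i)) (trans (cong t e) (section j)))
    ; edges = λ i → subst₂ (Adj G) (sym (section i)) (sym (section (next i))) (edges D i)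
    }

  adjacent↑ : ∀ {k l} (D : Cycle graph k) (D′ : Cycle graph l) → CyclesAdjacent D D′ → CyclesAdjacent (cycle↑ D) (cycle↑ D′)
  adjacent↑ _ _ (i , j , inj₁ (e₁ , e₂)) = i , j , inj₁ (cong t e₁ , cong t e₂)
  adjacent↑ _ _ (i , j , inj₂ (e₁ , e₂)) = i , j , inj₂ (cong t e₁ , cong t e₂)

  embedding : PlaneEmbedding G → PlaneEmbedding graph
  embedding E = record
    { pos = pos E ∘ t
    ; pos-inj = t-injective ∘ pos-inj E
    ; noVertexOnEdge = λ u v w uv w≢u w≢v →
        noVertexOnEdge E (t u) (t v) (t w) uv (w≢u ∘ t-injective) (w≢v ∘ t-injective)
    ; noCrossing = λ u v x y → noCrossing E (t u) (t v) (t x) (t y)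
    }

  inA : InA G → InA graph
  inA (E , no-triple) = embedding E , λ (C₃ , C₄ , C₅ , a₃₄ , a₃₅ , a₄₅) →
    no-triple (cycle↑ C₃ , cycle↑ C₄ , cycle↑ C₅ , adjacent↑ C₃ C₄ a₃₄ , adjacent↑ C₃ C₅ a₃₅ , adjacent↑ C₄ C₅ a₄₅)

  module _ {s} (H : Cover G s) where
    cover : Cover graph s
    cover = record
      { M = λ u i v j → Cover.M H (t u) i (t v) j
      ; M-sym = λ u i v j → Cover.M-sym H (t u) i (t v) j
      ; M-edge = λ u i v j → Cover.M-edge H (t u) i (t v) j
      ; M-match = λ u i v j j′ → Cover.M-match H (t u) i (t v) j j′
      }

    HAdj-cover : ∀ u i v j → HAdjᵇ cover u i v j ≡ HAdjᵇ H (t u) i (t v) j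
    HAdj-cover u i v j = cong (λ b → (b ∧ not ⌊ i ≟ j ⌋) ∨ Cover.M H (t u) i (t v) j)
      (trans (isYes≗does (u ≟ v)) (trans (does-⇔ (mk⇔ (cong t) t-injective) (u ≟ v) (t u ≟ t v))
        (sym (isYes≗does (t u ≟ t v)))))

    module _ {f : Fin s → Fin n → ℕ} {k} {col : Fin k → Fin s} where
      colouring↑ : ∀ {τ} → IsDPColoring cover (λ i → f i ∘ t) τ col → IsDPColoring H f (t ∘ τ) col
      colouring↑ {τ} = IsDPColoring-transport {H = cover} {H} {λ i → f i ∘ t} {f} {τ = τ} {t ∘ τ} {col}
        (λ j k → HAdj-cover _ _ _ _) (λ _ → refl)

      colouring↓ : ∀ {τ} (r : Fin n → Fin m) → (∀ i → t (r (τ i)) ≡ τ i) →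
        IsDPColoring H f τ col → IsDPColoring cover (λ i → f i ∘ t) (r ∘ τ) col
      colouring↓ {τ} r section = IsDPColoring-transport {H = H} {cover} {f} {λ i → f i ∘ t} {τ = τ} {r ∘ τ} {col}
        (λ j k → sym (trans (HAdj-cover _ _ _ _) (cong₂ (λ x y → HAdjᵇ H x (col j) y (col k)) (section j) (section k))))
        (λ k → cong (f (col k)) (sym (section k)))

module Induced {n} (G : Graph n) (p : Fin n → Bool) {x₀} (px₀ : T (p x₀)) where
  m : ℕ
  m = count p

  t : Fin m → Fin n
  t = enum p

  open Pullback G t (enum-injective p) public

  ix : Fin n → Fin m
  ix = indexOr p (index p x₀ px₀)

  t-ix : ∀ {v} → T (p v) → t (ix v) ≡ v
  t-ix = enum-indexOr p _ _

  ix-t : ∀ i → ix (t i) ≡ i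
  ix-t = indexOr-enum p _

  ix-injective : ∀ {u v} → T (p u) → T (p v) → ix u ≡ ix v → u ≡ v
  ix-injective pu pv e = trans (sym (t-ix pu)) (trans (cong t e) (t-ix pv))

  m<n : ∀ {v} → ¬ T (p v) → m < n
  m<n = count<n p _

module DPColouring {n} {G : Graph n} {s} (H : Cover G s) (f : Fin s → Fin n → ℕ)
                   {m} (τ : Fin m → Fin n) (col : Fin m → Fin s) (dp : IsDPColoring H f τ col) where
  ord : Fin m → Fin m
  ord = proj₁ dp

  ord-injective : Injective _≡_ _≡_ ord
  ord-injective = proj₁ (proj₂ dp)

  earlier : Fin m → Fin m → Bool
  earlier k j = ⌊ ord j <? ord k ⌋ ∧ HAdjᵇ H (τ j) (col j) (τ k) (col k)

  earlier-bound : ∀ k → count (earlier k) < f (col k) (τ k)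
  earlier-bound k = subst (_< _) (length-filterᵇ-tabulate (earlier k) id) (proj₂ (proj₂ dp) k)

  no-earlier-neighbour : ∀ {k j} → f (col k) (τ k) ≤ 1 → ¬ T (earlier k j)
  no-earlier-neighbour {k} {j} f≤1 e = <⇒≱ (count-pos (earlier k) j e) (s≤s⁻¹ (≤-trans (earlier-bound k) f≤1))

-- Splitting a counterexample along a separating triangle

record Separation {n} (X : Counterexample n) (C : Cycle (Counterexample.G X) 3) : Set₁ where
  open Counterexample X using (G; C₀)
  field
    Interior             : Fin n → Set
    interior?            : Decidable Interior
    corner-exterior      : ∀ k → ¬ Interior (vtx C k)
    precoloured-exterior : ∀ k → ¬ Interior (vtx C₀ k)
    separated            : ∀ {u w} → Interior u → ¬ Interior w → (∀ k → w ≢ vtx C k) → ¬ Adj G u w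
    interior-inhabited   : ∃ Interior
    exterior-inhabited   : ∃ λ w → ¬ Interior w × (∀ k → w ≢ vtx C k)

∣f∣-split₂ : ∀ {n s} (g : Fin (2 + s) → Fin n → ℕ) y →
  ∣f∣ g y ≡ g 0F y + (g 1F y + ∣f∣ (λ i → g (suc (suc i))) y)
∣f∣-split₂ {s = s} g y = cong (λ l → g 0F y + (g 1F y + sum l))
  (trans (map-tabulate (λ (i : Fin s) → suc (suc i)) (λ i → g i y)) (sym (map-tabulate id (λ i → g (suc (suc i)) y))))

module Splitting {n} (X : Counterexample n) (minimal : ∀ {n′} → Counterexample n′ → n ≤ n′)
                 {C : Cycle (Counterexample.G X) 3} (sep : Separation X C) where
  open Counterexample X
  open Separation sep

  Corner : Fin n → Set
  Corner v = ∃ λ k → v ≡ vtx C k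

  corner? : Decidable Corner
  corner? v = any? (λ k → v ≟ vtx C k)

  isCorner : Fin n → Bool
  isCorner v = ⌊ corner? v ⌋

  corner-not-interior : ∀ {v} → Corner v → ¬ Interior v
  corner-not-interior (k , refl) = corner-exterior k

  exterior inner : Fin n → Bool
  exterior v = ⌊ ¬? (interior? v) ⌋
  inner v = ⌊ interior? v ⊎-dec corner? v ⌋

  interior⇒inner : ∀ {v} → Interior v → T (inner v)
  interior⇒inner {v} iv = fromWitness {a? = interior? v ⊎-dec corner? v} (inj₁ iv)

  corner⇒inner : ∀ {v} → Corner v → T (inner v)
  corner⇒inner {v} cv = fromWitness {a? = interior? v ⊎-dec corner? v} (inj₂ cv)

  module O = Induced G exterior (fromWitness {a? = ¬? (interior? (vtx C 0F))} (corner-exterior 0F))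

  C₀ᴼ : Cycle O.graph 3
  C₀ᴼ = O.cycle↓ C₀ O.ix (λ k → O.t-ix (fromWitness (precoloured-exterior k)))

  fᴼ : Fin s → Fin O.m → ℕ
  fᴼ i = f i ∘ O.t

  OuterExtension : Set
  OuterExtension = Σ (Fin O.m → Fin s) λ c → IsDPColoring (O.cover H) fᴼ id c × (∀ k → c (vtx C₀ᴼ k) ≡ c₀ k)

  outer-extension : ¬ ¬ OuterExtension
  outer-extension none = <⇒≱ (O.m<n (λ e → toWitness e (proj₂ interior-inhabited))) (minimal outer)
    where
    outer : Counterexample O.m
    outer = record
      { G = O.graph ; G∈𝒜 = O.inA G∈𝒜 ; C₀ = C₀ᴼ ; s = s ; s≥1 = s≥1 ; H = O.cover H ; f = fᴼ
      ; f≤2 = λ i → f≤2 i ∘ O.t ; ∣f∣≥4 = ∣f∣≥4 ∘ O.t ; c₀ = c₀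
      ; R₀-DP = O.colouring↓ H {f = f} O.ix (λ k → O.t-ix (fromWitness (precoloured-exterior k))) R₀-DP
      ; noExt = none
      }

  old : Fin s → Fin (2 + s)
  old i = suc (suc i)

  -- The default is a junk value: off C the fresh colours have weight 0 and are never used.
  dropFresh : Fin s → Fin (2 + s) → Fin s
  dropFresh _ (suc (suc i)) = i
  dropFresh d _ = d

  -- Without the edges of H between corners, every precolouring of C is a DP-colouring.
  innerM : Fin n → Fin (2 + s) → Fin n → Fin (2 + s) → Bool
  innerM y (suc (suc i)) z (suc (suc j)) = not (isCorner y ∧ isCorner z) ∧ Cover.M H y i z j
  innerM _ _ _ _ = false

  innerM-sym : ∀ y i z j → innerM y i z j ≡ innerM z j y i
  innerM-sym y (suc (suc i)) z (suc (suc j)) =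
    cong₂ (λ b c → not b ∧ c) (∧-comm (isCorner y) (isCorner z)) (Cover.M-sym H y i z j)
  innerM-sym y 0F z 0F = refl
  innerM-sym y 0F z 1F = refl
  innerM-sym y 0F z (suc (suc j)) = refl
  innerM-sym y 1F z 0F = refl
  innerM-sym y 1F z 1F = refl
  innerM-sym y 1F z (suc (suc j)) = refl
  innerM-sym y (suc (suc i)) z 0F = refl
  innerM-sym y (suc (suc i)) z 1F = refl

  OldEdge : Fin n → Fin (2 + s) → Fin n → Fin (2 + s) → Set
  OldEdge y i z j = ∃ λ a → ∃ λ b → i ≡ old a × j ≡ old b × T (Cover.M H y a z b)

  innerM⇒OldEdge : ∀ {y z} i j → T (innerM y i z j) → OldEdge y i z j
  innerM⇒OldEdge (suc (suc a)) (suc (suc b)) h = a , b , refl , refl , proj₂ (Equivalence.to T-∧ h)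

  innerCover : Cover G (2 + s)
  innerCover = record
    { M = innerM
    ; M-sym = innerM-sym
    ; M-edge = λ y i z j → edge ∘ innerM⇒OldEdge i j
    ; M-match = λ y i z j j′ h h′ → match (innerM⇒OldEdge i j h) (innerM⇒OldEdge i j′ h′)
    }
    where
    edge : ∀ {y z i j} → OldEdge y i z j → Adj G y z
    edge (a , b , _ , _ , m) = Cover.M-edge H _ a _ b m

    match : ∀ {y z i j j′} → OldEdge y i z j → OldEdge y i z j′ → j ≡ j′
    match (a , b , refl , refl , m) (_ , b′ , refl , refl , m′) = cong old (Cover.M-match H _ a _ b b′ m m′)

  corners-not-inner-adjacent : ∀ {y z} a b → Corner y → Corner z → ¬ T (innerM y (old a) z (old b))
  corners-not-inner-adjacent {y} {z} a b cy cz with corner? y | corner? z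
  ... | yes _ | yes _ = λ ()
  ... | no ¬cy | _ = ⊥-elim (¬cy cy)
  ... | yes _ | no ¬cz = ⊥-elim (¬cz cz)

  innerM-of-M : ∀ {a b} i j → ¬ (Corner a × Corner b) → T (Cover.M H a i b j) → T (innerM a (old i) b (old j))
  innerM-of-M {a} {b} i j ¬both m with corner? a | corner? b
  ... | yes ca | yes cb = ⊥-elim (¬both (ca , cb))
  ... | yes _ | no _ = m
  ... | no _ | _ = m

  -- φ y is the colour of the corner y in the outer colouring; the two fresh colours 0F, 1F
  -- only serve to keep |f| ≥ 4 at the corners.
  module Inner (φ : Fin n → Fin s) where
    weight : Fin (2 + s) → Fin n → ℕ
    weight (suc (suc i)) y = if isCorner y then (if ⌊ i ≟ φ y ⌋ then 1 else 0) else f i y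
    weight _ y = if isCorner y then 2 else 0

    weight≤2 : ∀ i y → weight i y ≤ 2
    weight≤2 (suc (suc i)) y with isCorner y | ⌊ i ≟ φ y ⌋
    ... | true | true = s≤s z≤n
    ... | true | false = z≤n
    ... | false | _ = f≤2 i y
    weight≤2 0F y with isCorner y
    ... | true = ≤-refl
    ... | false = z≤n
    weight≤2 1F y with isCorner y
    ... | true = ≤-refl
    ... | false = z≤n

    weight-total : ∀ y → 4 ≤ ∣f∣ weight y
    weight-total y rewrite ∣f∣-split₂ weight y with isCorner y
    ... | true = m≤m+n 4 _
    ... | false = ∣f∣≥4 y

    weight-at-corner : ∀ {y} → Corner y → weight (old (φ y)) y ≡ 1
    weight-at-corner {y} cy with corner? y | φ y ≟ φ y
    ... | yes _ | yes _ = refl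
    ... | yes _ | no φy≢φy = ⊥-elim (φy≢φy refl)
    ... | no ¬cy | _ = ⊥-elim (¬cy cy)

    weight-off-corner : ∀ {y} i → ¬ Corner y → weight (old i) y ≡ f i y
    weight-off-corner {y} i ¬cy with corner? y
    ... | yes cy = ⊥-elim (¬cy cy)
    ... | no _ = refl

    positive-weight⇒old : ∀ {y} d c → ¬ Corner y → 0 < weight c y → c ≡ old (dropFresh d c)
    positive-weight⇒old d (suc (suc i)) ¬cy 0<w = refl
    positive-weight⇒old {y} d 0F ¬cy 0<w with corner? y
    ... | yes cy = ⊥-elim (¬cy cy)
    ... | no _ = ⊥-elim (<-irrefl refl 0<w)
    positive-weight⇒old {y} d 1F ¬cy 0<w with corner? y
    ... | yes cy = ⊥-elim (¬cy cy)
    ... | no _ = ⊥-elim (<-irrefl refl 0<w)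

    module I = Induced G inner (corner⇒inner (0F , refl))

    C₀ᴵ : Cycle I.graph 3
    C₀ᴵ = I.cycle↓ C I.ix (λ k → I.t-ix (corner⇒inner (k , refl)))

    c₀ᴵ : Fin 3 → Fin (2 + s)
    c₀ᴵ k = old (φ (vtx C k))

    fᴵ : Fin (2 + s) → Fin I.m → ℕ
    fᴵ i = weight i ∘ I.t

    corner-colouring : IsDPColoring innerCover weight (vtx C) c₀ᴵ
    corner-colouring = id , id , λ k →
      subst₂ _<_ (sym (trans (length-filterᵇ-tabulate (earlier k) id) (count-none (earlier k) (no-earlier k))))
                 (sym (weight-at-corner (k , refl))) (s≤s z≤n)
      where
      earlier : Fin 3 → Fin 3 → Bool
      earlier k j = ⌊ j <? k ⌋ ∧ HAdjᵇ innerCover (vtx C j) (c₀ᴵ j) (vtx C k) (c₀ᴵ k)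

      no-earlier : ∀ k j → ¬ T (earlier k j)
      no-earlier k j h = corners-not-inner-adjacent _ _ (j , refl) (k , refl)
        (subst T (HAdj-distinct innerCover _ _ (<⇒≢ (proj₁ (T-⌊⌋∧ (j <? k) h)) ∘ inj C)) (proj₂ (T-⌊⌋∧ (j <? k) h)))

    InnerExtension : Set
    InnerExtension = Σ (Fin I.m → Fin (2 + s)) λ c →
      IsDPColoring (I.cover innerCover) fᴵ id c × (∀ k → c (vtx C₀ᴵ k) ≡ c₀ᴵ k)

    inner-extension : ¬ ¬ InnerExtension
    inner-extension none = <⇒≱ (I.m<n w∉inner) (minimal inner-instance)
      where
      w = proj₁ exterior-inhabited

      w∉inner : ¬ T (inner w)
      w∉inner e with toWitness e
      ... | inj₁ interior = proj₁ (proj₂ exterior-inhabited) interior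
      ... | inj₂ (k , w≡) = proj₂ (proj₂ exterior-inhabited) k w≡

      inner-instance : Counterexample I.m
      inner-instance = record
        { G = I.graph ; G∈𝒜 = I.inA G∈𝒜 ; C₀ = C₀ᴵ ; s = 2 + s ; s≥1 = s≤s z≤n ; H = I.cover innerCover ; f = fᴵ
        ; f≤2 = λ i → weight≤2 i ∘ I.t ; ∣f∣≥4 = weight-total ∘ I.t ; c₀ = c₀ᴵ
        ; R₀-DP = I.colouring↓ innerCover {f = weight} I.ix (λ k → I.t-ix (corner⇒inner (k , refl))) corner-colouring
        ; noExt = none
        }

  module Glue (outer : OuterExtension) where
    cᴼ : Fin O.m → Fin s
    cᴼ = proj₁ outer

    module Dᴼ = DPColouring H f O.t cᴼ (O.colouring↑ H {f = f} {col = cᴼ} {τ = id} (proj₁ (proj₂ outer)))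

    φ : Fin n → Fin s
    φ = cᴼ ∘ O.ix

    open Inner φ public

    module _ (innerExt : InnerExtension) where
      cᴵ : Fin I.m → Fin (2 + s)
      cᴵ = proj₁ innerExt

      module Dᴵ = DPColouring innerCover weight I.t cᴵ
        (I.colouring↑ innerCover {f = weight} {col = cᴵ} {τ = id} (proj₁ (proj₂ innerExt)))

      col : Fin n → Fin s
      col v = if ⌊ interior? v ⌋ then dropFresh (φ v) (cᴵ (I.ix v)) else φ v

      col-interior : ∀ {v} → Interior v → col v ≡ dropFresh (φ v) (cᴵ (I.ix v))
      col-interior {v} = if-yes (interior? v)

      col-exterior : ∀ {v} → ¬ Interior v → col v ≡ φ v
      col-exterior {v} = if-no (interior? v)

      inner-colour-old : ∀ x → cᴵ x ≡ old (col (I.t x))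
      inner-colour-old x with toWitness {a? = interior? (I.t x) ⊎-dec corner? (I.t x)} (enum-satisfies inner x)
      ... | inj₁ it =
        trans (positive-weight⇒old (φ (I.t x)) (cᴵ x) (λ cx → corner-not-interior cx it) (≤-<-trans z≤n (Dᴵ.earlier-bound x)))
              (cong old (sym (trans (col-interior it) (cong (dropFresh (φ (I.t x)) ∘ cᴵ) (I.ix-t x)))))
      ... | inj₂ (k , tx≡) =
        trans (cong cᴵ (trans (sym (I.ix-t x)) (cong I.ix tx≡)))
              (trans (proj₂ (proj₂ innerExt) k) (cong old (sym (trans (col-exterior (corner-not-interior (k , tx≡))) (cong φ tx≡)))))

      key : Fin n → ℕ
      key v = if ⌊ interior? v ⌋ then O.m + toℕ (Dᴵ.ord (I.ix v)) else toℕ (Dᴼ.ord (O.ix v))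

      key-interior : ∀ {v} → Interior v → key v ≡ O.m + toℕ (Dᴵ.ord (I.ix v))
      key-interior {v} = if-yes (interior? v)

      key-exterior : ∀ {v} → ¬ Interior v → key v ≡ toℕ (Dᴼ.ord (O.ix v))
      key-exterior {v} = if-no (interior? v)

      exterior-key< : ∀ {v} → ¬ Interior v → key v < O.m
      exterior-key< ¬iv = subst (_< O.m) (sym (key-exterior ¬iv)) (toℕ<n _)

      interior-key≥ : ∀ {v} → Interior v → O.m ≤ key v
      interior-key≥ iv = subst (O.m ≤_) (sym (key-interior iv)) (m≤m+n O.m _)

      key-injective : Injective _≡_ _≡_ key
      key-injective {u} {v} e = by-sides (interior? u) (interior? v)
        where
        by-sides : Dec (Interior u) → Dec (Interior v) → u ≡ v
        by-sides (yes iu) (yes iv) = I.ix-injective (interior⇒inner iu) (interior⇒inner iv)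
          (Dᴵ.ord-injective (toℕ-injective (+-cancelˡ-≡ O.m _ _ (trans (sym (key-interior iu)) (trans e (key-interior iv))))))
        by-sides (no ¬iu) (no ¬iv) = O.ix-injective (fromWitness ¬iu) (fromWitness ¬iv)
          (Dᴼ.ord-injective (toℕ-injective (trans (sym (key-exterior ¬iu)) (trans e (key-exterior ¬iv)))))
        by-sides (yes iu) (no ¬iv) = ⊥-elim (<⇒≱ (exterior-key< ¬iv) (subst (O.m ≤_) e (interior-key≥ iu)))
        by-sides (no ¬iu) (yes iv) = ⊥-elim (<⇒≱ (exterior-key< ¬iu) (subst (O.m ≤_) (sym e) (interior-key≥ iv)))

      open Rank key key-injective

      before : Fin n → Fin n → Bool
      before k j = ⌊ rank j <? rank k ⌋ ∧ HAdjᵇ H j (col j) k (col k)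

      before⇒ : ∀ {k j} → T (before k j) → key j < key k × T (Cover.M H j (col j) k (col k))
      before⇒ {k} {j} h = kj<kk , subst T (HAdj-distinct H _ _ j≢k) (proj₂ (T-⌊⌋∧ (rank j <? rank k) h))
        where
        kj<kk = rank<⇒key< (proj₁ (T-⌊⌋∧ (rank j <? rank k) h))

        j≢k : j ≢ k
        j≢k refl = <-irrefl refl kj<kk

      bound-exterior : ∀ {k} → ¬ Interior k → count (before k) < f (col k) k
      bound-exterior {k} ¬ik =
        ≤-<-trans (count-≤ (before k) (Dᴼ.earlier kᴼ) O.t lift)
                  (subst (count (Dᴼ.earlier kᴼ) <_) (cong₂ f (sym (col-exterior ¬ik)) t-kᴼ) (Dᴼ.earlier-bound kᴼ))
        where
        kᴼ = O.ix k

        t-kᴼ : O.t kᴼ ≡ k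
        t-kᴼ = O.t-ix (fromWitness ¬ik)

        lift : ∀ j → T (before k j) → ∃ λ y → O.t y ≡ j × T (Dᴼ.earlier kᴼ y)
        lift j h = O.ix j , t-jᴼ , Equivalence.from T-∧ (ordered , adjacent)
          where
          kj<kk = proj₁ (before⇒ h)

          ¬ij : ¬ Interior j
          ¬ij ij = <⇒≱ (<-trans kj<kk (exterior-key< ¬ik)) (interior-key≥ ij)

          t-jᴼ : O.t (O.ix j) ≡ j
          t-jᴼ = O.t-ix (fromWitness ¬ij)

          ordered : T ⌊ Dᴼ.ord (O.ix j) <? Dᴼ.ord kᴼ ⌋
          ordered = fromWitness (subst₂ _<_ (key-exterior ¬ij) (key-exterior ¬ik) kj<kk)

          adjacent : T (HAdjᵇ H (O.t (O.ix j)) (φ j) (O.t kᴼ) (φ k))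
          adjacent = subst₂ (λ a b → T (HAdjᵇ H a (φ j) b (φ k))) (sym t-jᴼ) (sym t-kᴼ)
            (subst₂ (λ c c′ → T (HAdjᵇ H j c k c′)) (col-exterior ¬ij) (col-exterior ¬ik) (M⇒HAdj H (proj₂ (before⇒ h))))

      old-colour : ∀ {v} → T (inner v) → cᴵ (I.ix v) ≡ old (col v)
      old-colour iv = trans (inner-colour-old (I.ix _)) (cong (old ∘ col) (I.t-ix iv))

      weight-of : ∀ {v} → T (inner v) → weight (cᴵ (I.ix v)) (I.t (I.ix v)) ≡ weight (old (col v)) v
      weight-of iv = cong₂ weight (old-colour iv) (I.t-ix iv)

      inner-adjacent : ∀ {a b} → T (inner a) → T (inner b) → a ≢ b → ¬ (Corner a × Corner b) →
        T (Cover.M H a (col a) b (col b)) → T (HAdjᵇ innerCover (I.t (I.ix a)) (cᴵ (I.ix a)) (I.t (I.ix b)) (cᴵ (I.ix b)))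
      inner-adjacent {a} {b} ia ib a≢b ¬both m =
        subst₂ (λ x y → T (HAdjᵇ innerCover x (cᴵ (I.ix a)) y (cᴵ (I.ix b)))) (sym (I.t-ix ia)) (sym (I.t-ix ib))
          (subst₂ (λ c c′ → T (HAdjᵇ innerCover a c b c′)) (sym (old-colour ia)) (sym (old-colour ib))
            (subst T (sym (HAdj-distinct innerCover _ _ a≢b)) (innerM-of-M _ _ ¬both m)))

      interior-neighbour : ∀ {k j} → Interior k → T (Cover.M H k (col k) j (col j)) → Interior j ⊎ Corner j
      interior-neighbour {k} {j} ik m = by-cases (interior? j) (corner? j)
        where
        by-cases : Dec (Interior j) → Dec (Corner j) → Interior j ⊎ Corner j
        by-cases (yes ij) _ = inj₁ ij
        by-cases (no _) (yes cj) = inj₂ cj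
        by-cases (no ¬ij) (no ¬cj) =
          ⊥-elim (separated ik ¬ij (λ l e → ¬cj (l , e)) (Cover.M-edge H k (col k) j (col j) m))

      -- A corner has weight 1 in the inner instance, so no inner neighbour precedes it.
      corner-precedes : ∀ {k j} → Interior k → Corner j → T (Cover.M H k (col k) j (col j)) →
        Dᴵ.ord (I.ix j) Fin.< Dᴵ.ord (I.ix k)
      corner-precedes {k} {j} ik cj m = decidable-stable (Dᴵ.ord (I.ix j) <? Dᴵ.ord (I.ix k)) λ j≮k →
        Dᴵ.no-earlier-neighbour (≤-reflexive weight≡1)
          (Equivalence.from T-∧ (fromWitness (k<j j≮k) , inner-adjacent (interior⇒inner ik) (corner⇒inner cj) k≢j (¬ck ∘ proj₁) m))
        where
        ¬ck : ¬ Corner k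
        ¬ck ck = corner-not-interior ck ik

        k≢j : k ≢ j
        k≢j refl = ¬ck cj

        weight≡1 : weight (cᴵ (I.ix j)) (I.t (I.ix j)) ≡ 1
        weight≡1 = trans (weight-of (corner⇒inner cj))
          (trans (cong (λ c → weight (old c) j) (col-exterior (corner-not-interior cj))) (weight-at-corner cj))

        k<j : ¬ (Dᴵ.ord (I.ix j) Fin.< Dᴵ.ord (I.ix k)) → Dᴵ.ord (I.ix k) Fin.< Dᴵ.ord (I.ix j)
        k<j j≮k = ≤∧≢⇒< (≮⇒≥ j≮k)
          (k≢j ∘ I.ix-injective (interior⇒inner ik) (corner⇒inner cj) ∘ Dᴵ.ord-injective ∘ toℕ-injective)

      bound-interior : ∀ {k} → Interior k → count (before k) < f (col k) k
      bound-interior {k} ik =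
        ≤-<-trans (count-≤ (before k) (Dᴵ.earlier (I.ix k)) I.t lift)
                  (subst (count (Dᴵ.earlier (I.ix k)) <_) (trans (weight-of (interior⇒inner ik)) (weight-off-corner (col k) ¬ck))
                         (Dᴵ.earlier-bound (I.ix k)))
        where
        ¬ck : ¬ Corner k
        ¬ck ck = corner-not-interior ck ik

        lift : ∀ j → T (before k j) → ∃ λ y → I.t y ≡ j × T (Dᴵ.earlier (I.ix k) y)
        lift j h = I.ix j , I.t-ix j-inner ,
                   Equivalence.from T-∧ (fromWitness ordered , inner-adjacent j-inner (interior⇒inner ik) j≢k (¬ck ∘ proj₂) m)
          where
          kj<kk = proj₁ (before⇒ h)
          m = proj₂ (before⇒ h)

          j≢k : j ≢ k
          j≢k refl = <-irrefl refl kj<kk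

          m′ : T (Cover.M H k (col k) j (col j))
          m′ = subst T (Cover.M-sym H j (col j) k (col k)) m

          side : Interior j ⊎ Corner j
          side = interior-neighbour ik m′

          j-inner : T (inner j)
          j-inner = fromWitness side

          ordered : Dᴵ.ord (I.ix j) Fin.< Dᴵ.ord (I.ix k)
          ordered = [ (λ ij → +-cancelˡ-< O.m _ _ (subst₂ _<_ (key-interior ij) (key-interior ik) kj<kk))
                    , (λ cj → corner-precedes ik cj m′) ]′ side

      extension : Σ (Fin n → Fin s) λ c → IsDPColoring H f id c × (∀ k → c (vtx C₀ k) ≡ c₀ k)
      extension = col , (rank , rank-injective , bound) , λ k → trans (col-exterior (precoloured-exterior k)) (proj₂ (proj₂ outer) k)
        where
        bound : ∀ k → length (filterᵇ (before k) (allFin n)) < f (col k) k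
        bound k = subst (_< f (col k) k) (sym (length-filterᵇ-tabulate (before k) id)) (by-side (interior? k))
          where
          by-side : Dec (Interior k) → count (before k) < f (col k) k
          by-side (yes ik) = bound-interior ik
          by-side (no ¬ik) = bound-exterior ¬ik

  separation-impossible : ⊥
  separation-impossible = outer-extension λ outer → Glue.inner-extension outer λ innerExt → noExt (Glue.extension outer innerExt)

-- The sides of a separating triangle

module _ {n} (X : Counterexample n) (E : PlaneEmbedding (Counterexample.G X)) (C : Cycle (Counterexample.G X) 3) where
  open Counterexample X using (G; C₀)

  not-a-corner : ∀ {w} → ¬ InClosed E C w → ∀ k → w ≢ vtx C k
  not-a-corner w-out k refl = w-out (corner-closed E C k)

  inside-separation : (∀ k → ¬ Inside E C (vtx C₀ k)) → ∃ (Inside E C) → (∃ λ w → ¬ InClosed E C w) → Separation X C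
  inside-separation C₀-outside (w₁ , w₁-in) (w₂ , w₂-out) = record
    { Interior = Inside E C
    ; interior? = inside? E C
    ; corner-exterior = corner-not-inside E C
    ; precoloured-exterior = C₀-outside
    ; separated = inside-nonadjacent E C
    ; interior-inhabited = w₁ , w₁-in
    ; exterior-inhabited = w₂ , w₂-out ∘ inside⇒closed E C , not-a-corner w₂-out
    }

  outside-separation : ∀ k₀ → Inside E C (vtx C₀ k₀) → ∃ (Inside E C) → (∃ λ w → ¬ InClosed E C w) → Separation X C
  outside-separation k₀ k₀-in (w₁ , w₁-in) (w₂ , w₂-out) = record
    { Interior = Outside
    ; interior? = λ v → ¬? (inside? E C v) ×-dec all? (λ k → ¬? (v ≟ vtx C k))
    ; corner-exterior = λ k (_ , not-corner) → not-corner k refl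
    ; precoloured-exterior = precoloured-not-outside
    ; separated = separated
    ; interior-inhabited = w₂ , w₂-out ∘ inside⇒closed E C , not-a-corner w₂-out
    ; exterior-inhabited = w₁ , (λ (w₁-out , _) → w₁-out w₁-in) , λ k w₁≡ → corner-not-inside E C k (subst (Inside E C) w₁≡ w₁-in)
    }
    where
    Outside : Fin n → Set
    Outside v = ¬ Inside E C v × (∀ k → v ≢ vtx C k)

    precoloured-not-outside : ∀ k → ¬ Outside (vtx C₀ k)
    precoloured-not-outside k (out , not-corner) with k₀ ≟ k
    ... | yes refl = out k₀-in
    ... | no k₀≢k = inside-nonadjacent E C k₀-in out not-corner (triangle-adjacent C₀ k₀≢k)

    separated : ∀ {u w} → Outside u → ¬ Outside w → (∀ k → w ≢ vtx C k) → ¬ Adj G u w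
    separated {u} {w} (u-out , u-not-corner) ¬w-out w-not-corner uw =
      inside-nonadjacent E C w-in u-out u-not-corner (Adj-sym G uw)
      where
      w-in = decidable-stable (inside? E C w) (λ w-out → ¬w-out (w-out , w-not-corner))

lemma5 : ∀ {n} (X : Counterexample n) →
         (∀ {n′} → Counterexample n′ → n ≤ n′) →
         (E : PlaneEmbedding (Counterexample.G X)) →
         (C : Cycle (Counterexample.G X) 3) →
         ¬ SeparatingTriangle E C
lemma5 X minimal E C (inside , outside) with any? (λ k → inside? E C (vtx (Counterexample.C₀ X) k))
... | no none-inside = Splitting.separation-impossible X minimal (inside-separation X E C (λ k i → none-inside (k , i)) inside outside)
... | yes (k₀ , k₀-in) = Splitting.separation-impossible X minimal (outside-separation X E C k₀ k₀-in inside outside)
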